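{- Let $n\ge3$ and let $C_n$ be a directed cycle graph on vertices $v_1,\dots,v_n$ (in cyclic order) such that not every arrow of $C_n$ is bi-directional. Then: (1) $C_n$ has a vertex of out-degree $0$ or $1$. (2) Suppose (after cyclic relabeling) $v_n$ has out-degree $0$, so the arrows at $v_n$ are $v_{n-1}\to v_n$ and $v_1\to v_n$. Let $C'_{n+1}$ (the degree zero extension) be the directed cycle graph on $v_1,\dots,v_{n+1}$ obtained by removing the arrow $v_1\to v_n$ and adding a new vertex $v_{n+1}$ with arrows $v_n\to v_{n+1}$ and $v_1\to v_{n+1}$. Then $\operatorname{Pic}(C_n)\cong\operatorname{Pic}(C'_{n+1})$. (3) Suppose (after relabeling) $v_n$ has out-degree $1$ with arrows $v_{n-1}\to v_n$ and either $v_n\to v_1$ or a bi-directional arrow $v_n\leftrightarrow v_1$. Let $C''_{n+1}$ (the degree one extension) be obtained by removing the arrow between $v_n$ and $v_1$ and adding a new vertex $v_{n+1}$ with arrows $v_n\to v_{n+1}$ and, respectively, $v_{n+1}\to v_1$ or $v_{n+1}\leftrightarrow v_1$. Then $\operatorname{Pic}(C_n)\cong\operatorname{Pic}(C''_{n+1})$.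
   Context: A directed cycle graph $C_n$ ($n\ge3$) has vertices $v_1,\dots,v_n$ and, for each cyclically consecutive pair $v_i,v_{i+1}$ (indices mod $n$), exactly one arrow, either one-directional or bi-directional. A bi-directional arrow between $u,w$ counts as an arrow from $u$ to $w$ and as one from $w$ to $u$; the out-degree of a vertex is its number of outgoing arrows (bi-directional ones included). The Laplacian $L_G$ of a directed graph $G$ on $v_1,\dots,v_m$ is the $m\times m$ integer matrix with $(i,i)$ entry the out-degree of $v_i$ and $(i,j)$ entry ($i\ne j$) minus the number of arrows from $v_i$ to $v_j$. $\operatorname{Pic}(G)=\mathbb{Z}^m/L_G^T\mathbb{Z}^m$. -}

module Defs where

open import Level using (0ℓ)
open import Data.Bool.Base using (Bool; true; false; _∧_; _∨_; if_then_else_)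
open import Data.Nat.Base as ℕ using (ℕ; zero; suc; pred)
import Data.Nat.Properties as ℕP
open import Data.Fin.Base using (Fin; zero; suc; toℕ; fromℕ; fromℕ<)
open import Data.Fin.Properties using (_≟_)
open import Data.Integer.Base using (ℤ; +_; _+_; _*_; -_; _-_; 0ℤ)
open import Data.Integer.Tactic.RingSolver using (solve-∀)
open import Data.Product.Base using (Σ; ∃; _,_; proj₁; proj₂)
open import Relation.Binary.PropositionalEquality
open import Relation.Nullary.Decidable using (yes; no; ⌊_⌋)
open import Algebra.Bundles using (AbelianGroup; RawGroup)
open import Algebra.Morphism.Structures using (module GroupMorphisms)

Σℕ : ∀ {m} → (Fin m → ℕ) → ℕ
Σℕ {zero}  f = 0
Σℕ {suc m} f = f zero ℕ.+ Σℕ (λ i → f (suc i))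

Σℤ : ∀ {m} → (Fin m → ℤ) → ℤ
Σℤ {zero}  f = 0ℤ
Σℤ {suc m} f = f zero + Σℤ (λ i → f (suc i))

-- Directed graphs (possibly with multiple arrows) on vertices Fin m,
-- given by the number of arrows from v_i to v_j.

Digraph : ℕ → Set
Digraph m = Fin m → Fin m → ℕ

outdeg : ∀ {m} → Digraph m → Fin m → ℕ
outdeg G i = Σℕ (λ j → G i j)

Laplacian : ∀ {m} → Digraph m → Fin m → Fin m → ℤ
Laplacian G i j with i ≟ j
... | yes _ = + outdeg G i
... | no  _ = - (+ G i j)

LT· : ∀ {m} → Digraph m → (Fin m → ℤ) → Fin m → ℤ
LT· G c i = Σℤ (λ j → Laplacian G j i * c j)

-- Pic(G) = ℤ^m / L_G^T ℤ^m, as an abelian group whose carrier is ℤ^m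
-- and whose equality is congruence modulo the image of L_G^T.

_≈[_]_ : ∀ {m} → (Fin m → ℤ) → Digraph m → (Fin m → ℤ) → Set
x ≈[ G ] y = ∃ λ c → ∀ i → x i - y i ≡ LT· G c i

private
  Σℤ-0 : ∀ {m} → Σℤ {m} (λ _ → 0ℤ) ≡ 0ℤ
  Σℤ-0 {zero} = refl
  Σℤ-0 {suc m} = cong (λ t → 0ℤ + t) (Σℤ-0 {m})

  Σℤ-cong : ∀ {m} {f g : Fin m → ℤ} → (∀ i → f i ≡ g i) → Σℤ f ≡ Σℤ g
  Σℤ-cong {zero} e = refl
  Σℤ-cong {suc m} e = cong₂ _+_ (e zero) (Σℤ-cong (λ i → e (suc i)))

  Σℤ-+ : ∀ {m} (f g : Fin m → ℤ) → Σℤ (λ i → f i + g i) ≡ Σℤ f + Σℤ g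
  Σℤ-+ {zero} f g = refl
  Σℤ-+ {suc m} f g
    rewrite Σℤ-+ (λ i → f (suc i)) (λ i → g (suc i)) =
    solve-∀' (f zero) (g zero) (Σℤ (λ i → f (suc i))) (Σℤ (λ i → g (suc i)))
    where
    solve-∀' : ∀ a b c d → a + b + (c + d) ≡ a + c + (b + d)
    solve-∀' = solve-∀

  Σℤ-neg : ∀ {m} (f : Fin m → ℤ) → Σℤ (λ i → - f i) ≡ - Σℤ f
  Σℤ-neg {zero} f = refl
  Σℤ-neg {suc m} f rewrite Σℤ-neg (λ i → f (suc i)) =
    s (f zero) (Σℤ (λ i → f (suc i)))
    where
    s : ∀ a b → - a + - b ≡ - (a + b)
    s = solve-∀

  module _ {m} (G : Digraph m) where
    LT-0 : ∀ i → LT· G (λ _ → 0ℤ) i ≡ 0ℤ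
    LT-0 i = trans (Σℤ-cong (λ j → s (Laplacian G j i))) (Σℤ-0 {m})
      where s : ∀ a → a * 0ℤ ≡ 0ℤ
            s = solve-∀

    LT-+ : ∀ c d i → LT· G (λ j → c j + d j) i ≡ LT· G c i + LT· G d i
    LT-+ c d i = trans (Σℤ-cong (λ j → s (Laplacian G j i) (c j) (d j))) (Σℤ-+ {m} _ _)
      where s : ∀ a b e → a * (b + e) ≡ a * b + a * e
            s = solve-∀

    LT-neg : ∀ c i → LT· G (λ j → - c j) i ≡ - LT· G c i
    LT-neg c i = trans (Σℤ-cong (λ j → s (Laplacian G j i) (c j))) (Σℤ-neg {m} _)
      where s : ∀ a b → a * - b ≡ - (a * b)
            s = solve-∀

    ≡⇒≈ : {x y : Fin m → ℤ} → (∀ i → x i ≡ y i) → x ≈[ G ] y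
    ≡⇒≈ {x} {y} e = (λ _ → 0ℤ) , λ i →
      trans (cong (_- y i) (e i)) (trans (s (y i)) (sym (LT-0 i)))
      where s : ∀ a → a - a ≡ 0ℤ
            s = solve-∀

    ≈-sym : {x y : Fin m → ℤ} → x ≈[ G ] y → y ≈[ G ] x
    ≈-sym {x} {y} (c , p) = (λ j → - c j) , λ i →
      trans (s (x i) (y i)) (trans (cong -_ (p i)) (sym (LT-neg c i)))
      where s : ∀ a b → b - a ≡ - (a - b)
            s = solve-∀

    ≈-trans : {x y z : Fin m → ℤ} → x ≈[ G ] y → y ≈[ G ] z → x ≈[ G ] z
    ≈-trans {x} {y} {z} (c , p) (d , q) = (λ j → c j + d j) , λ i →
      trans (s (x i) (y i) (z i)) (trans (cong₂ _+_ (p i) (q i)) (sym (LT-+ c d i)))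
      where s : ∀ a b e → a - e ≡ (a - b) + (b - e)
            s = solve-∀

    +-cong≈ : {x y u v : Fin m → ℤ} → x ≈[ G ] y → u ≈[ G ] v →
              (λ i → x i + u i) ≈[ G ] (λ i → y i + v i)
    +-cong≈ {x} {y} {u} {v} (c , p) (d , q) = (λ j → c j + d j) , λ i →
      trans (s (x i) (y i) (u i) (v i)) (trans (cong₂ _+_ (p i) (q i)) (sym (LT-+ c d i)))
      where s : ∀ a b e f → (a + e) - (b + f) ≡ (a - b) + (e - f)
            s = solve-∀

    neg-cong≈ : {x y : Fin m → ℤ} → x ≈[ G ] y → (λ i → - x i) ≈[ G ] (λ i → - y i)
    neg-cong≈ {x} {y} (c , p) = (λ j → - c j) , λ i →
      trans (s (x i) (y i)) (trans (cong -_ (p i)) (sym (LT-neg c i)))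
      where s : ∀ a b → - a - - b ≡ - (a - b)
            s = solve-∀

Pic : ∀ {m} → Digraph m → AbelianGroup 0ℓ 0ℓ
Pic {m} G = record
  { Carrier = Fin m → ℤ
  ; _≈_ = λ x y → x ≈[ G ] y
  ; _∙_ = λ x y i → x i + y i
  ; ε = λ _ → 0ℤ
  ; _⁻¹ = λ x i → - x i
  ; isAbelianGroup = record
    { isGroup = record
      { isMonoid = record
        { isSemigroup = record
          { isMagma = record
            { isEquivalence = record
              { refl = λ {x} → ≡⇒≈ G {x} {x} (λ _ → refl)
              ; sym = λ {x} {y} → ≈-sym G {x} {y}
              ; trans = λ {x} {y} {z} → ≈-trans G {x} {y} {z}
              }
            ; ∙-cong = λ {x} {y} {u} {v} → +-cong≈ G {x} {y} {u} {v}
            }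
          ; assoc = λ x y z → ≡⇒≈ G (λ i → s₁ (x i) (y i) (z i))
          }
        ; identity = (λ x → ≡⇒≈ G (λ i → s₂ (x i)))
                   , (λ x → ≡⇒≈ G (λ i → s₃ (x i)))
        }
      ; inverse = (λ x → ≡⇒≈ G (λ i → s₄ (x i)))
                , (λ x → ≡⇒≈ G (λ i → s₅ (x i)))
      ; ⁻¹-cong = λ {x} {y} → neg-cong≈ G {x} {y}
      }
    ; comm = λ x y → ≡⇒≈ G (λ i → s₆ (x i) (y i))
    }
  }
  where
  s₁ : ∀ a b c → a + b + c ≡ a + (b + c)
  s₁ = solve-∀
  s₂ : ∀ a → 0ℤ + a ≡ a
  s₂ = solve-∀
  s₃ : ∀ a → a + 0ℤ ≡ a
  s₃ = solve-∀
  s₄ : ∀ a → - a + a ≡ 0ℤ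
  s₄ = solve-∀
  s₅ : ∀ a → a + - a ≡ 0ℤ
  s₅ = solve-∀
  s₆ : ∀ a b → a + b ≡ b + a
  s₆ = solve-∀

_≅ᴾ_ : ∀ {m k} → Digraph m → Digraph k → Set
_≅ᴾ_ {m} {k} G H =
  ∃ λ (f : (Fin m → ℤ) → (Fin k → ℤ)) →
    GroupMorphisms.IsGroupIsomorphism
      (AbelianGroup.rawGroup (Pic G)) (AbelianGroup.rawGroup (Pic H)) f

-- Vertices v_1,…,v_n are Fin n (v_{k+1} ↦ index k).  Edge k (k : Fin n)
-- joins vertex k and vertex `next k` (= k+1 mod n), and carries exactly
-- one arrow of the given type:
--   fwd : v_k → v_{k+1},   bwd : v_{k+1} → v_k,   bi : v_k ↔ v_{k+1}.

data Arrow : Set where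
  fwd bwd bi : Arrow

next : ∀ {n} → Fin n → Fin n
next {suc m} i with toℕ i ℕP.<? m
... | yes p = fromℕ< (ℕ.s≤s p)
... | no  _ = zero

private
  goesFwd goesBwd : Arrow → Bool
  goesFwd fwd = true
  goesFwd bwd = false
  goesFwd bi  = true
  goesBwd fwd = false
  goesBwd bwd = true
  goesBwd bi  = true

  ind : Bool → ℕ
  ind b = if b then 1 else 0

cycle : ∀ {n} → (Fin n → Arrow) → Digraph n
cycle a i j = Σℕ (λ k →
    ind (goesFwd (a k) ∧ ⌊ i ≟ k ⌋ ∧ ⌊ j ≟ next k ⌋)
  ℕ.+ ind (goesBwd (a k) ∧ ⌊ i ≟ next k ⌋ ∧ ⌊ j ≟ k ⌋))

-- For C_n with n = suc m: the last vertex v_n is `fromℕ m`; the edge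
-- between v_n and v_1 is edge `fromℕ m`; the edge between v_{n-1} and
-- v_n is edge `penult` (index m-1).
penult : ∀ {m} → Fin (suc m)
penult {m} = fromℕ< (ℕ.s≤s (ℕP.pred[n]≤n {m}))

-- Extension of C_n (n = suc m) to a cycle on v_1,…,v_{n+1}: the arrow
-- between v_n and v_1 is removed, and a new vertex v_{n+1} is added with
-- an arrow v_n → v_{n+1} and, between v_{n+1} and v_1, an arrow of the
-- same type as the removed one (edges 0,…,m-1 are unchanged).
-- * If the removed arrow is v_1 → v_n (bwd), this is the degree zero
--   extension C'_{n+1} (new arrow v_1 → v_{n+1}).
-- * If it is v_n → v_1 (fwd) or v_n ↔ v_1 (bi), this is the degree one
--   extension C''_{n+1} (new arrow v_{n+1} → v_1, resp. v_{n+1} ↔ v_1).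
extend : ∀ {m} → (Fin (suc m) → Arrow) → Fin (suc (suc m)) → Arrow
extend {m} a i with toℕ i ℕP.<? m
... | yes p = a (fromℕ< (ℕP.m<n⇒m<1+n p))
... | no  _ with toℕ i ℕP.≟ m
...   | yes _ = fwd
...   | no  _ = a (fromℕ m)

degZeroExtension degOneExtension :
  ∀ {m} → (Fin (suc m) → Arrow) → Fin (suc (suc m)) → Arrow
degZeroExtension = extend
degOneExtension  = extend

-- A firing vector c sends the flow w_k = [v_k → v_{k+1}] c_k − [v_{k+1} → v_k] c_{k+1}
-- along edge k of the cycle, and (L^T c)_i = w_i − w_{i−1} is the divergence of that
-- flow; so Pic(C_n) is ℤ^n modulo divergences of flows of firing vectors.
--
-- (1) An edge that is not bi-directional leaves one of its endpoints with no outgoing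
-- arrow along it, and that endpoint has out-degree at most one.
-- (2), (3) In both cases the arrow between v_{n−1} and v_n is v_{n−1} → v_n (forced by
-- out-degree 0 in (2), assumed in (3)).  Hence in the extension the firing value of
-- v_n only enters the flow along the new edge v_n → v_{n+1}, which is therefore free,
-- while all other flows are those of C_n.  So the flows of the extension are the flows
-- of C_n with one arbitrary entry inserted, and padding chip vectors with 0 at v_{n+1}
-- is inverse, on Picard groups, to moving the chips of v_{n+1} onto v_n.

module Submission where

open import Defs
open import Algebra.Bundles using (CommutativeMonoid; AbelianGroup)
import Algebra.Properties.CommutativeMonoid.Sum as Sum
open import Data.Bool.Base using (Bool; true; false; _∧_; if_then_else_)
open import Data.Nat.Base as ℕ using (ℕ; zero; suc)
import Data.Nat.Properties as ℕP
import Data.Nat.Tactic.RingSolver as ℕRing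
open import Data.Fin.Base using (Fin; zero; suc; toℕ; fromℕ; inject₁; punchIn)
open import Data.Fin.Properties
  using (_≟_; punchInᵢ≢i; ¬∀⟶∃¬; 0≢1+n; toℕ-injective; toℕ-fromℕ<; toℕ-inject₁; toℕ-fromℕ; inject₁ℕ<; toℕ<n)
open import Data.Product.Base using (_×_; _,_; map₂; ∃-syntax)
open import Data.Sum.Base using (_⊎_; inj₁; inj₂)
open import Data.Integer.Base using (ℤ; +_; _+_; _*_; -_; _-_; 0ℤ)
import Data.Integer.Properties as ℤP
open import Data.Integer.Tactic.RingSolver using (solve-∀)
open import Data.Vec.Functional using (Vector; insertAt; removeAt; init; tail; map; zipWith)
open import Data.Vec.Functional.Properties using (insertAt-lookup; insertAt-removeAt)
open import Relation.Binary.PropositionalEquality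
  using (_≡_; _≢_; refl; sym; trans; cong; cong₂; subst; _≗_; module ≡-Reasoning)
open import Relation.Nullary.Decidable using (Dec; ⌊_⌋; yes; no)
open import Relation.Nullary.Negation using (¬_; contradiction)

module _ {c ℓ} (M : CommutativeMonoid c ℓ) where
  open CommutativeMonoid M
  open Sum M using (sum; sum-remove; sum-cong-≋; sum-replicate-zero)

  sum-single : ∀ {n} (f : Vector Carrier (suc n)) (p : Fin (suc n)) →
               (∀ k → k ≢ p → f k ≈ ε) → sum f ≈ f p
  sum-single {n} f p f≈ε = begin
    sum f                              ≈⟨ sum-remove f ⟩
    f p ∙ sum (λ k → f (punchIn p k))  ≈⟨ ∙-congˡ (sum-cong-≋ {n} (λ k → f≈ε _ (punchInᵢ≢i p k))) ⟩
    f p ∙ sum {n} (λ _ → ε)            ≈⟨ ∙-congˡ (sum-replicate-zero n) ⟩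
    f p ∙ ε                            ≈⟨ identityʳ (f p) ⟩
    f p                                ∎
    where open import Relation.Binary.Reasoning.Setoid setoid

module ℕΣ = Sum ℕP.+-0-commutativeMonoid
module ℤΣ = Sum ℤP.+-0-commutativeMonoid

Σℕ≡sum : ∀ {n} (f : Fin n → ℕ) → Σℕ f ≡ ℕΣ.sum f
Σℕ≡sum {zero}  f = refl
Σℕ≡sum {suc n} f = cong (f zero ℕ.+_) (Σℕ≡sum (λ k → f (suc k)))

Σℤ≡sum : ∀ {n} (f : Fin n → ℤ) → Σℤ f ≡ ℤΣ.sum f
Σℤ≡sum {zero}  f = refl
Σℤ≡sum {suc n} f = cong (λ s → f zero + s) (Σℤ≡sum (λ k → f (suc k)))

Σℕ-cong : ∀ {n} {f g : Fin n → ℕ} → f ≗ g → Σℕ f ≡ Σℕ g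
Σℕ-cong {f = f} {g} f≗g = trans (Σℕ≡sum f) (trans (ℕΣ.sum-cong-≗ f≗g) (sym (Σℕ≡sum g)))

Σℤ-cong : ∀ {n} {f g : Fin n → ℤ} → f ≗ g → Σℤ f ≡ Σℤ g
Σℤ-cong {f = f} {g} f≗g = trans (Σℤ≡sum f) (trans (ℤΣ.sum-cong-≗ f≗g) (sym (Σℤ≡sum g)))

Σℕ-distrib-+ : ∀ {n} (f g : Fin n → ℕ) → Σℕ (λ k → f k ℕ.+ g k) ≡ Σℕ f ℕ.+ Σℕ g
Σℕ-distrib-+ f g =
  trans (Σℕ≡sum (λ k → f k ℕ.+ g k)) (trans (ℕΣ.∑-distrib-+ f g) (sym (cong₂ ℕ._+_ (Σℕ≡sum f) (Σℕ≡sum g))))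

Σℤ-distrib-+ : ∀ {n} (f g : Fin n → ℤ) → Σℤ (λ k → f k + g k) ≡ Σℤ f + Σℤ g
Σℤ-distrib-+ f g =
  trans (Σℤ≡sum (λ k → f k + g k)) (trans (ℤΣ.∑-distrib-+ f g) (sym (cong₂ _+_ (Σℤ≡sum f) (Σℤ≡sum g))))

𝟙 : Bool → ℕ
𝟙 b = if b then 1 else 0

𝟙-∧ : ∀ b c → 𝟙 (b ∧ c) ≡ 𝟙 b ℕ.* 𝟙 c
𝟙-∧ true  c = sym (ℕP.*-identityˡ (𝟙 c))
𝟙-∧ false c = refl

δ : ∀ {n} → Fin n → Fin n → ℕ
δ i j = 𝟙 ⌊ i ≟ j ⌋

δ-refl : ∀ {n} (i : Fin n) → δ i i ≡ 1
δ-refl i with i ≟ i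
... | yes _  = refl
... | no i≢i = contradiction refl i≢i

δ-≢ : ∀ {n} {i j : Fin n} → i ≢ j → δ i j ≡ 0
δ-≢ {i = i} {j} i≢j with i ≟ j
... | yes i≡j = contradiction i≡j i≢j
... | no _    = refl

δ-resp-⇔ : ∀ {n} {i j k l : Fin n} → (i ≡ j → k ≡ l) → (k ≡ l → i ≡ j) → δ i j ≡ δ k l
δ-resp-⇔ {i = i} {j} {k} {l} to from with i ≟ j | k ≟ l
... | yes _   | yes _   = refl
... | no _    | no _    = refl
... | yes i≡j | no k≢l  = contradiction (to i≡j) k≢l
... | no i≢j  | yes k≡l = contradiction (from k≡l) i≢j

δ-sym : ∀ {n} (i j : Fin n) → δ i j ≡ δ j i
δ-sym i j = δ-resp-⇔ sym sym

Σℕ-sift : ∀ {n} (p : Fin (suc n)) (g : Fin (suc n) → ℕ) → Σℕ (λ k → δ p k ℕ.* g k) ≡ g p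
Σℕ-sift p g = begin
  Σℕ (λ k → δ p k ℕ.* g k)      ≡⟨ Σℕ≡sum (λ k → δ p k ℕ.* g k) ⟩
  ℕΣ.sum (λ k → δ p k ℕ.* g k)  ≡⟨ sum-single ℕP.+-0-commutativeMonoid _ p
                                     (λ k k≢p → cong (ℕ._* g k) (δ-≢ (λ p≡k → k≢p (sym p≡k)))) ⟩
  δ p p ℕ.* g p                  ≡⟨ cong (ℕ._* g p) (δ-refl p) ⟩
  1 ℕ.* g p                      ≡⟨ ℕP.*-identityˡ (g p) ⟩
  g p                            ∎
  where open ≡-Reasoning

Σℤ-sift : ∀ {n} (p : Fin (suc n)) (g : Fin (suc n) → ℤ) → Σℤ (λ k → + δ p k * g k) ≡ g p
Σℤ-sift p g = begin
  Σℤ (λ k → + δ p k * g k)      ≡⟨ Σℤ≡sum (λ k → + δ p k * g k) ⟩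
  ℤΣ.sum (λ k → + δ p k * g k)  ≡⟨ sum-single ℤP.+-0-commutativeMonoid _ p
                                     (λ k k≢p → cong (λ d → + d * g k) (δ-≢ (λ p≡k → k≢p (sym p≡k)))) ⟩
  + δ p p * g p                  ≡⟨ cong (λ d → + d * g p) (δ-refl p) ⟩
  + 1 * g p                      ≡⟨ ℤP.*-identityˡ (g p) ⟩
  g p                            ∎
  where open ≡-Reasoning

data Inject₁OrLast {n} : Fin (suc n) → Set where
  inject : (i : Fin n) → Inject₁OrLast (inject₁ i)
  last   : Inject₁OrLast (fromℕ n)

inject₁-or-last : ∀ {n} (i : Fin (suc n)) → Inject₁OrLast i
inject₁-or-last {zero}  zero    = last
inject₁-or-last {suc n} zero    = inject zero
inject₁-or-last {suc n} (suc i) with inject₁-or-last i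
... | inject j = inject (suc j)
... | last     = last

prev : ∀ {n} → Fin (suc n) → Fin (suc n)
prev {n} zero = fromℕ n
prev (suc i)  = inject₁ i

next-inject₁ : ∀ {n} (i : Fin n) → next (inject₁ i) ≡ suc i
next-inject₁ {n} i with toℕ (inject₁ i) ℕP.<? n
... | yes p = toℕ-injective (trans (toℕ-fromℕ< (ℕ.s≤s p)) (cong suc (toℕ-inject₁ i)))
... | no ¬p = contradiction (inject₁ℕ< i) ¬p

next-fromℕ : ∀ n → next (fromℕ n) ≡ zero
next-fromℕ n with toℕ (fromℕ n) ℕP.<? n
... | yes p = contradiction (subst (ℕ._< n) (toℕ-fromℕ n) p) (ℕP.n≮n n)
... | no _  = refl

next-prev : ∀ {n} (i : Fin (suc n)) → next (prev i) ≡ i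
next-prev {n} zero = next-fromℕ n
next-prev (suc i)  = next-inject₁ i

prev-next : ∀ {n} (i : Fin (suc n)) → prev (next i) ≡ i
prev-next i with inject₁-or-last i
... | inject j = cong prev (next-inject₁ j)
... | last     = cong prev (next-fromℕ _)

next≢ : ∀ {n} (i : Fin (suc (suc n))) → next i ≢ i
next≢ i with inject₁-or-last i
... | inject j = λ e → ℕP.1+n≢n (trans (cong toℕ (trans (sym (next-inject₁ j)) e)) (toℕ-inject₁ j))
... | last     = λ e → 0≢1+n (trans (sym (next-fromℕ _)) e)

δ-next : ∀ {n} (i j : Fin (suc n)) → δ i (next j) ≡ δ (prev i) j
δ-next i j = δ-resp-⇔ (λ i≡next-j → trans (cong prev i≡next-j) (prev-next j))
                      (λ prev-i≡j → trans (sym (next-prev i)) (cong next prev-i≡j))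

fwdCount bwdCount : Arrow → ℕ
fwdCount fwd = 1
fwdCount bwd = 0
fwdCount bi  = 1
bwdCount fwd = 0
bwdCount bwd = 1
bwdCount bi  = 1

arrowsOnEdge : ∀ {n} → Arrow → (i j k : Fin n) → ℕ
arrowsOnEdge t i j k = δ i k ℕ.* (δ j (next k) ℕ.* fwdCount t) ℕ.+ δ j k ℕ.* (δ i (next k) ℕ.* bwdCount t)

private
  arrowsOnEdge-𝟙 : ∀ {n} (i j k : Fin n) (f b : Bool) →
    𝟙 (f ∧ ⌊ i ≟ k ⌋ ∧ ⌊ j ≟ next k ⌋) ℕ.+ 𝟙 (b ∧ ⌊ i ≟ next k ⌋ ∧ ⌊ j ≟ k ⌋)
      ≡ δ i k ℕ.* (δ j (next k) ℕ.* 𝟙 f) ℕ.+ δ j k ℕ.* (δ i (next k) ℕ.* 𝟙 b)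
  arrowsOnEdge-𝟙 i j k f b
    rewrite 𝟙-∧ f (⌊ i ≟ k ⌋ ∧ ⌊ j ≟ next k ⌋) | 𝟙-∧ ⌊ i ≟ k ⌋ ⌊ j ≟ next k ⌋
          | 𝟙-∧ b (⌊ i ≟ next k ⌋ ∧ ⌊ j ≟ k ⌋) | 𝟙-∧ ⌊ i ≟ next k ⌋ ⌊ j ≟ k ⌋ =
    ring (𝟙 f) (δ i k) (δ j (next k)) (𝟙 b) (δ i (next k)) (δ j k)
    where
    ring : ∀ f x y b u v → f ℕ.* (x ℕ.* y) ℕ.+ b ℕ.* (u ℕ.* v) ≡ x ℕ.* (y ℕ.* f) ℕ.+ v ℕ.* (u ℕ.* b)
    ring = ℕRing.solve-∀

  -- The arrow predicates that `cycle` is built from are private to Defs: its summand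
  -- is recovered as the meta S by unification, and then computed arrow by arrow.
  cycle-by-summand : ∀ {n} (i j : Fin n) (S : (Fin n → Arrow) → Fin n → ℕ) (T : Arrow → Fin n → ℕ) →
    (∀ a → cycle a i j ≡ Σℕ (S a)) → (∀ a k → S a k ≡ S (λ _ → a k) k) →
    (∀ t k → S (λ _ → t) k ≡ T t k) → ∀ a → cycle a i j ≡ Σℕ (λ k → T (a k) k)
  cycle-by-summand i j S T unfold local byArrow a =
    trans (unfold a) (Σℕ-cong (λ k → trans (local a k) (byArrow (a k) k)))

cycle≡Σ-arrowsOnEdge : ∀ {n} (a : Fin n → Arrow) (i j : Fin n) →
  cycle a i j ≡ Σℕ (λ k → arrowsOnEdge (a k) i j k)
cycle≡Σ-arrowsOnEdge a i j = cycle-by-summand i j _ (λ t k → arrowsOnEdge t i j k) (λ _ → refl) (λ _ _ → refl)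
  (λ { fwd k → arrowsOnEdge-𝟙 i j k true false
     ; bwd k → arrowsOnEdge-𝟙 i j k false true
     ; bi  k → arrowsOnEdge-𝟙 i j k true true })
  a

cycle-arrows : ∀ {n} (a : Fin (suc n) → Arrow) (i j : Fin (suc n)) →
  cycle a i j ≡ δ j (next i) ℕ.* fwdCount (a i) ℕ.+ δ i (next j) ℕ.* bwdCount (a j)
cycle-arrows a i j = begin
  cycle a i j                                               ≡⟨ cycle≡Σ-arrowsOnEdge a i j ⟩
  Σℕ (λ k → δ i k ℕ.* F k ℕ.+ δ j k ℕ.* B k)               ≡⟨ Σℕ-distrib-+ (λ k → δ i k ℕ.* F k) (λ k → δ j k ℕ.* B k) ⟩
  Σℕ (λ k → δ i k ℕ.* F k) ℕ.+ Σℕ (λ k → δ j k ℕ.* B k)  ≡⟨ cong₂ ℕ._+_ (Σℕ-sift i F) (Σℕ-sift j B) ⟩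
  F i ℕ.+ B j                                               ∎
  where
  open ≡-Reasoning
  F B : Fin _ → ℕ
  F k = δ j (next k) ℕ.* fwdCount (a k)
  B k = δ i (next k) ℕ.* bwdCount (a k)

cycle-loopless : ∀ {n} (a : Fin (suc (suc n)) → Arrow) i → cycle a i i ≡ 0
cycle-loopless a i rewrite cycle-arrows a i i | δ-≢ (λ i≡next-i → next≢ i (sym i≡next-i)) = refl

outdeg-cycle : ∀ {n} (a : Fin (suc n) → Arrow) (i : Fin (suc n)) →
  outdeg (cycle a) i ≡ fwdCount (a i) ℕ.+ bwdCount (a (prev i))
outdeg-cycle a i = begin
  Σℕ (λ j → cycle a i j)
    ≡⟨ Σℕ-cong (λ j → trans (cycle-arrows a i j)
         (cong₂ (λ d e → d ℕ.* fwdCount (a i) ℕ.+ e ℕ.* bwdCount (a j)) (δ-sym j (next i)) (δ-next i j))) ⟩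
  Σℕ (λ j → δ (next i) j ℕ.* fwdCount (a i) ℕ.+ δ (prev i) j ℕ.* bwdCount (a j))
    ≡⟨ Σℕ-distrib-+ (λ j → δ (next i) j ℕ.* fwdCount (a i)) (λ j → δ (prev i) j ℕ.* bwdCount (a j)) ⟩
  Σℕ (λ j → δ (next i) j ℕ.* fwdCount (a i)) ℕ.+ Σℕ (λ j → δ (prev i) j ℕ.* bwdCount (a j))
    ≡⟨ cong₂ ℕ._+_ (Σℕ-sift (next i) (λ _ → fwdCount (a i))) (Σℕ-sift (prev i) (λ j → bwdCount (a j))) ⟩
  fwdCount (a i) ℕ.+ bwdCount (a (prev i))
    ∎
  where open ≡-Reasoning

inflow-cycle : ∀ {n} (a : Fin (suc n) → Arrow) (c : Fin (suc n) → ℤ) i →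
  Σℤ (λ j → + cycle a j i * c j) ≡ + fwdCount (a (prev i)) * c (prev i) + + bwdCount (a i) * c (next i)
inflow-cycle a c i = begin
  Σℤ (λ j → + cycle a j i * c j)
    ≡⟨ Σℤ-cong term ⟩
  Σℤ (λ j → + δ (prev i) j * F j + + δ (next i) j * B j)
    ≡⟨ Σℤ-distrib-+ (λ j → + δ (prev i) j * F j) (λ j → + δ (next i) j * B j) ⟩
  Σℤ (λ j → + δ (prev i) j * F j) + Σℤ (λ j → + δ (next i) j * B j)
    ≡⟨ cong₂ _+_ (Σℤ-sift (prev i) F) (Σℤ-sift (next i) B) ⟩
  F (prev i) + B (next i)
    ∎
  where
  open ≡-Reasoning
  F B : Fin _ → ℤ
  F j = + fwdCount (a j) * c j
  B j = + bwdCount (a i) * c j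
  distribute : ∀ x f y b z → + (x ℕ.* f ℕ.+ y ℕ.* b) * z ≡ + x * (+ f * z) + + y * (+ b * z)
  distribute x f y b z =
    trans (cong (_* z) (trans (ℤP.pos-+ (x ℕ.* f) (y ℕ.* b)) (cong₂ _+_ (ℤP.pos-* x f) (ℤP.pos-* y b))))
          (ring (+ x) (+ f) (+ y) (+ b) z)
    where ring : ∀ x f y b z → (x * f + y * b) * z ≡ x * (f * z) + y * (b * z)
          ring = solve-∀
  term : ∀ j → + cycle a j i * c j ≡ + δ (prev i) j * F j + + δ (next i) j * B j
  term j = begin
    + cycle a j i * c j
      ≡⟨ cong (λ x → + x * c j) (cycle-arrows a j i) ⟩
    + (δ i (next j) ℕ.* fwdCount (a j) ℕ.+ δ j (next i) ℕ.* bwdCount (a i)) * c j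
      ≡⟨ cong₂ (λ d e → + (d ℕ.* fwdCount (a j) ℕ.+ e ℕ.* bwdCount (a i)) * c j) (δ-next i j) (δ-sym j (next i)) ⟩
    + (δ (prev i) j ℕ.* fwdCount (a j) ℕ.+ δ (next i) j ℕ.* bwdCount (a i)) * c j
      ≡⟨ distribute (δ (prev i) j) (fwdCount (a j)) (δ (next i) j) (bwdCount (a i)) (c j) ⟩
    + δ (prev i) j * F j + + δ (next i) j * B j
      ∎

outdeg≤1-at-head : ∀ {n} (a : Fin (suc n) → Arrow) k → a k ≡ fwd → outdeg (cycle a) (next k) ℕ.≤ 1
outdeg≤1-at-head a k ak≡fwd rewrite outdeg-cycle a (next k) | prev-next k | ak≡fwd
  | ℕP.+-identityʳ (fwdCount (a (next k))) = fwdCount≤1 (a (next k))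
  where
  fwdCount≤1 : ∀ t → fwdCount t ℕ.≤ 1
  fwdCount≤1 fwd = ℕP.≤-refl
  fwdCount≤1 bwd = ℕ.z≤n
  fwdCount≤1 bi  = ℕP.≤-refl

outdeg≤1-at-tail : ∀ {n} (a : Fin (suc n) → Arrow) k → a k ≡ bwd → outdeg (cycle a) k ℕ.≤ 1
outdeg≤1-at-tail a k ak≡bwd rewrite outdeg-cycle a k | ak≡bwd = bwdCount≤1 (a (prev k))
  where
  bwdCount≤1 : ∀ t → bwdCount t ℕ.≤ 1
  bwdCount≤1 fwd = ℕ.z≤n
  bwdCount≤1 bwd = ℕP.≤-refl
  bwdCount≤1 bi  = ℕP.≤-refl

_≟bi : (t : Arrow) → Dec (t ≡ bi)
fwd ≟bi = no (λ ())
bwd ≟bi = no (λ ())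
bi  ≟bi = yes refl

∃outdeg≤1 : ∀ {n} (a : Fin (suc n) → Arrow) → ¬ (∀ k → a k ≡ bi) → ∃[ v ] outdeg (cycle a) v ℕ.≤ 1
∃outdeg≤1 {n} a notAllBi with ¬∀⟶∃¬ (suc n) (λ k → a k ≡ bi) (λ k → a k ≟bi) notAllBi
... | k , ak≢bi with a k in ak≡
...   | fwd = next k , outdeg≤1-at-head a k ak≡
...   | bwd = k , outdeg≤1-at-tail a k ak≡
...   | bi  = contradiction refl ak≢bi

outdeg≡0⇒fwd-into : ∀ {n} (a : Fin (suc n) → Arrow) i → outdeg (cycle a) i ≡ 0 → a (prev i) ≡ fwd
outdeg≡0⇒fwd-into a i outdeg≡0 =
  bwdCount≡0⇒fwd (ℕP.m+n≡0⇒n≡0 (fwdCount (a i)) (trans (sym (outdeg-cycle a i)) outdeg≡0))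
  where
  bwdCount≡0⇒fwd : ∀ {t} → bwdCount t ≡ 0 → t ≡ fwd
  bwdCount≡0⇒fwd {fwd} _ = refl

module _ {n} (G : Digraph n) where

  Laplacian-diag : ∀ i → Laplacian G i i ≡ + outdeg G i
  Laplacian-diag i with i ≟ i
  ... | yes _  = refl
  ... | no i≢i = contradiction refl i≢i

  Laplacian-off : ∀ {i j} → i ≢ j → Laplacian G i j ≡ - (+ G i j)
  Laplacian-off {i} {j} i≢j with i ≟ j
  ... | yes i≡j = contradiction i≡j i≢j
  ... | no _    = refl

  LT·-cong : ∀ {c d : Fin n → ℤ} → c ≗ d → LT· G c ≗ LT· G d
  LT·-cong c≗d i = Σℤ-cong (λ j → cong (Laplacian G j i *_) (c≗d j))

LT·+inflow : ∀ {n} (G : Digraph (suc n)) → (∀ i → G i i ≡ 0) → ∀ c i →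
  LT· G c i + Σℤ (λ j → + G j i * c j) ≡ + outdeg G i * c i
LT·+inflow G loopless c i = begin
  LT· G c i + Σℤ (λ j → + G j i * c j)
    ≡⟨ Σℤ-distrib-+ (λ j → Laplacian G j i * c j) (λ j → + G j i * c j) ⟨
  Σℤ (λ j → Laplacian G j i * c j + + G j i * c j)
    ≡⟨ Σℤ-cong (λ j → term j (j ≟ i)) ⟩
  Σℤ (λ j → + δ i j * (+ outdeg G i * c i))
    ≡⟨ Σℤ-sift i (λ _ → + outdeg G i * c i) ⟩
  + outdeg G i * c i
    ∎
  where
  open ≡-Reasoning
  term : ∀ j → Dec (j ≡ i) → Laplacian G j i * c j + + G j i * c j ≡ + δ i j * (+ outdeg G i * c i)
  term j (yes refl) = begin
    Laplacian G j j * c j + + G j j * c j  ≡⟨ cong₂ (λ l g → l * c j + + g * c j) (Laplacian-diag G j) (loopless j) ⟩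
    + outdeg G j * c j + 0ℤ                ≡⟨ ℤP.+-identityʳ _ ⟩
    + outdeg G j * c j                     ≡⟨ ℤP.*-identityˡ _ ⟨
    + 1 * (+ outdeg G j * c j)             ≡⟨ cong (λ d → + d * (+ outdeg G j * c j)) (δ-refl j) ⟨
    + δ j j * (+ outdeg G j * c j)         ∎
  term j (no j≢i) = begin
    Laplacian G j i * c j + + G j i * c j  ≡⟨ cong (λ l → l * c j + + G j i * c j) (Laplacian-off G j≢i) ⟩
    - (+ G j i) * c j + + G j i * c j      ≡⟨ cong (_+ + G j i * c j) (ℤP.neg-distribˡ-* (+ G j i) (c j)) ⟨
    - (+ G j i * c j) + + G j i * c j      ≡⟨ ℤP.+-inverseˡ (+ G j i * c j) ⟩
    0ℤ                                     ≡⟨ cong (λ d → + d * (+ outdeg G i * c i)) (δ-≢ (λ i≡j → j≢i (sym i≡j))) ⟨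
    + δ i j * (+ outdeg G i * c i)         ∎

edgeFlow : Arrow → ℤ → ℤ → ℤ
edgeFlow t x y = + fwdCount t * x - + bwdCount t * y

edgeFlow-cong : ∀ {t t′ x x′ y y′} → t ≡ t′ → x ≡ x′ → y ≡ y′ → edgeFlow t x y ≡ edgeFlow t′ x′ y′
edgeFlow-cong refl refl refl = refl

edgeFlow-fwd : ∀ x y → edgeFlow fwd x y ≡ x
edgeFlow-fwd = ring
  where ring : ∀ x y → + 1 * x - + 0 * y ≡ x
        ring = solve-∀

edgeFlow-zero : ∀ t → edgeFlow t 0ℤ 0ℤ ≡ 0ℤ
edgeFlow-zero fwd = refl
edgeFlow-zero bwd = refl
edgeFlow-zero bi  = refl

flow : ∀ {n} → (Fin n → Arrow) → (Fin n → ℤ) → Fin n → ℤ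
flow a c k = edgeFlow (a k) (c k) (c (next k))

flow-fwd : ∀ {n} (a : Fin n → Arrow) (c : Fin n → ℤ) k → a k ≡ fwd → flow a c k ≡ c k
flow-fwd a c k ak≡fwd = trans (edgeFlow-cong ak≡fwd refl refl) (edgeFlow-fwd (c k) (c (next k)))

divergence : ∀ {n} → (Fin (suc n) → ℤ) → Fin (suc n) → ℤ
divergence w i = w i - w (prev i)

LT·-cycle : ∀ {n} (a : Fin (suc (suc n)) → Arrow) (c : Fin (suc (suc n)) → ℤ) i →
  LT· (cycle a) c i ≡ divergence (flow a c) i
LT·-cycle a c i = begin
  LT· (cycle a) c i
    ≡⟨ isolate (trans (LT·+inflow (cycle a) (cycle-loopless a) c i) (cong (λ d → + d * c i) (outdeg-cycle a i))) ⟩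
  + (fwdCount (a i) ℕ.+ bwdCount (a (prev i))) * c i - Σℤ (λ j → + cycle a j i * c j)
    ≡⟨ cong₂ (λ x y → x * c i - y) (ℤP.pos-+ (fwdCount (a i)) (bwdCount (a (prev i)))) (inflow-cycle a c i) ⟩
  (+ fwdCount (a i) + + bwdCount (a (prev i))) * c i
    - (+ fwdCount (a (prev i)) * c (prev i) + + bwdCount (a i) * c (next i))
    ≡⟨ ring (+ fwdCount (a i)) (+ bwdCount (a i)) (+ fwdCount (a (prev i))) (+ bwdCount (a (prev i)))
            (c i) (c (next i)) (c (prev i)) ⟩
  flow a c i - edgeFlow (a (prev i)) (c (prev i)) (c i)
    ≡⟨ cong (λ v → flow a c i - edgeFlow (a (prev i)) (c (prev i)) (c v)) (next-prev i) ⟨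
  divergence (flow a c) i
    ∎
  where
  open ≡-Reasoning
  isolate : ∀ {x y z} → x + y ≡ z → x ≡ z - y
  isolate {x} {y} refl = cancel x y
    where cancel : ∀ x y → x ≡ x + y - y
          cancel = solve-∀
  ring : ∀ f b fp bp ci cn cp → (f + bp) * ci - (fp * cp + b * cn) ≡ (f * ci - b * cn) - (fp * cp - bp * ci)
  ring = solve-∀

≗⇒≈ : ∀ {n} (G : Digraph n) {x y : Fin n → ℤ} → x ≗ y → x ≈[ G ] y
≗⇒≈ G {x} {y} x≗y with AbelianGroup.refl (Pic G) {x}
... | c , x-x≡ = c , λ i → trans (cong (λ z → x i - z) (sym (x≗y i))) (x-x≡ i)

≅ᴾ-byInverse : ∀ {m k} (G : Digraph m) (H : Digraph k)
  (f : (Fin m → ℤ) → Fin k → ℤ) (g : (Fin k → ℤ) → Fin m → ℤ) →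
  (∀ x y → f (λ i → x i + y i) ≗ (λ j → f x j + f y j)) →
  f (λ _ → 0ℤ) ≗ (λ _ → 0ℤ) →
  (∀ x → f (λ i → - x i) ≗ (λ j → - f x j)) →
  (∀ {x y} → x ≈[ G ] y → f x ≈[ H ] f y) →
  (∀ {x y} → x ≈[ H ] y → g x ≈[ G ] g y) →
  (∀ x → g (f x) ≗ x) →
  (∀ y → f (g y) ≈[ H ] y) →
  G ≅ᴾ H
≅ᴾ-byInverse G H f g f-+ f-0 f-neg f-cong g-cong g∘f f∘g = f , record
  { isGroupMonomorphism = record
    { isGroupHomomorphism = record
      { isMonoidHomomorphism = record
        { isMagmaHomomorphism = record
          { isRelHomomorphism = record { cong = f-cong }
          ; homo = λ x y → ≗⇒≈ H (f-+ x y)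
          }
        ; ε-homo = ≗⇒≈ H f-0
        }
      ; ⁻¹-homo = λ x → ≗⇒≈ H (f-neg x)
      }
    ; injective = injective
    }
  ; surjective = λ y → g y , λ {z} z≈gy → AbelianGroup.trans (Pic H) {f z} {f (g y)} {y} (f-cong {z} {g y} z≈gy) (f∘g y)
  }
  where
  injective : ∀ {x y} → f x ≈[ H ] f y → x ≈[ G ] y
  injective {x} {y} fx≈fy = begin
    x        ≈⟨ ≗⇒≈ G (g∘f x) ⟨
    g (f x)  ≈⟨ g-cong {f x} {f y} fx≈fy ⟩
    g (f y)  ≈⟨ ≗⇒≈ G (g∘f y) ⟩
    y        ∎
    where open import Relation.Binary.Reasoning.Setoid (AbelianGroup.setoid (Pic G))

module _ {A : Set} where

  insertAt-fromℕ-inject₁ : ∀ {n} (w : Vector A n) u (k : Fin n) → insertAt w (fromℕ n) u (inject₁ k) ≡ w k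
  insertAt-fromℕ-inject₁ {suc n} w u zero    = refl
  insertAt-fromℕ-inject₁ {suc n} w u (suc k) = insertAt-fromℕ-inject₁ (tail w) u k

  insertAt-penult-inject₁ : ∀ {n} (w : Vector A (suc n)) u (k : Fin n) →
    insertAt w (inject₁ (fromℕ n)) u (inject₁ (inject₁ k)) ≡ w (inject₁ k)
  insertAt-penult-inject₁ {suc n} w u zero    = refl
  insertAt-penult-inject₁ {suc n} w u (suc k) = insertAt-penult-inject₁ (tail w) u k

  insertAt-penult-last : ∀ {n} (w : Vector A (suc n)) u →
    insertAt w (inject₁ (fromℕ n)) u (fromℕ (suc n)) ≡ w (fromℕ n)
  insertAt-penult-last {zero}  w u = refl
  insertAt-penult-last {suc n} w u = insertAt-penult-last (tail w) u

module _ {A B C : Set} where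

  insertAt-zipWith : ∀ {n} (f : A → B → C) (xs : Vector A n) (ys : Vector B n) i u v →
    insertAt (zipWith f xs ys) i (f u v) ≗ zipWith f (insertAt xs i u) (insertAt ys i v)
  insertAt-zipWith         f xs ys zero    u v zero    = refl
  insertAt-zipWith         f xs ys zero    u v (suc j) = refl
  insertAt-zipWith {suc n} f xs ys (suc i) u v zero    = refl
  insertAt-zipWith {suc n} f xs ys (suc i) u v (suc j) = insertAt-zipWith f (tail xs) (tail ys) i u v j

module _ {A B : Set} where

  insertAt-map : ∀ {n} (f : A → B) (xs : Vector A n) i u → insertAt (map f xs) i (f u) ≗ map f (insertAt xs i u)
  insertAt-map         f xs zero    u zero    = refl
  insertAt-map         f xs zero    u (suc j) = refl
  insertAt-map {suc n} f xs (suc i) u zero    = refl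
  insertAt-map {suc n} f xs (suc i) u (suc j) = insertAt-map f (tail xs) i u j

extend-inner : ∀ {m} (a : Fin (suc m) → Arrow) (k : Fin m) → extend a (inject₁ (inject₁ k)) ≡ a (inject₁ k)
extend-inner {m} a k with toℕ (inject₁ (inject₁ k)) ℕP.<? m
... | yes _ = cong a (toℕ-injective (trans (toℕ-fromℕ< _) (toℕ-inject₁ (inject₁ k))))
... | no ¬p = contradiction (subst (ℕ._< m) (sym (trans (toℕ-inject₁ (inject₁ k)) (toℕ-inject₁ k))) (toℕ<n k)) ¬p

extend-hinge : ∀ {m} (a : Fin (suc m) → Arrow) → extend a (inject₁ (fromℕ m)) ≡ fwd
extend-hinge {m} a with toℕ (inject₁ (fromℕ m)) ℕP.<? m
... | yes p = contradiction (subst (ℕ._< m) (trans (toℕ-inject₁ (fromℕ m)) (toℕ-fromℕ m)) p) (ℕP.n≮n m)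
... | no _ with toℕ (inject₁ (fromℕ m)) ℕP.≟ m
...   | yes _ = refl
...   | no ¬e = contradiction (trans (toℕ-inject₁ (fromℕ m)) (toℕ-fromℕ m)) ¬e

extend-last : ∀ {m} (a : Fin (suc m) → Arrow) → extend a (fromℕ (suc m)) ≡ a (fromℕ m)
extend-last {m} a with toℕ (fromℕ (suc m)) ℕP.<? m
... | yes p = contradiction (subst (ℕ._< m) (toℕ-fromℕ (suc m)) p) (ℕP.<-asym (ℕP.n<1+n m))
... | no _ with toℕ (fromℕ (suc m)) ℕP.≟ m
...   | yes e = contradiction (trans (sym (toℕ-fromℕ (suc m))) e) ℕP.1+n≢n
...   | no _  = refl

-- In the paper's numbering: v_1, …, v_{n−1}, the hinge v_n, and the new vertex v_{n+1}.
data ExtensionVertex {n} : Fin (suc (suc (suc n))) → Set where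
  inner : (k : Fin (suc n)) → ExtensionVertex (inject₁ (inject₁ k))
  hinge : ExtensionVertex (inject₁ (fromℕ (suc n)))
  new   : ExtensionVertex (fromℕ (suc (suc n)))

extensionVertex : ∀ {n} (v : Fin (suc (suc (suc n)))) → ExtensionVertex v
extensionVertex v with inject₁-or-last v
... | last     = new
... | inject u with inject₁-or-last u
...   | inject k = inner k
...   | last     = hinge

module Extension {n} (a : Fin (suc (suc n)) → Arrow) (a-penult : a (inject₁ (fromℕ n)) ≡ fwd) where

  N N′ : ℕ
  N  = suc (suc n)
  N′ = suc N

  h : Fin N′
  h = inject₁ (fromℕ (suc n))

  -- Index h is both the hinge vertex v_n and the new edge v_n → v_{n+1}.
  ins : Vector ℤ N → ℤ → Vector ℤ N′
  ins w u = insertAt w h u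

  a′ : Fin N′ → Arrow
  a′ = extend a

  C C′ : Digraph _
  C  = cycle a
  C′ = cycle a′

  flow-extend : ∀ c u → flow a′ (ins c u) ≗ ins (flow a c) u
  flow-extend c u v with extensionVertex v
  ... | inner k with inject₁-or-last k
  ...   | inject k₀ = trans
            (edgeFlow-cong (extend-inner a (inject₁ k₀)) (insertAt-penult-inject₁ c u (inject₁ k₀)) ins-next)
            (sym (insertAt-penult-inject₁ (flow a c) u (inject₁ k₀)))
    where
    ins-next : ins c u (next (inject₁ (inject₁ (inject₁ k₀)))) ≡ c (next (inject₁ (inject₁ k₀)))
    ins-next = trans (cong (ins c u) (next-inject₁ (inject₁ (inject₁ k₀))))
                 (trans (insertAt-penult-inject₁ c u (suc k₀)) (cong c (sym (next-inject₁ (inject₁ k₀)))))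
  ...   | last = begin
            flow a′ (ins c u) (inject₁ p)  ≡⟨ flow-fwd a′ (ins c u) (inject₁ p) (trans (extend-inner a (fromℕ n)) a-penult) ⟩
            ins c u (inject₁ p)            ≡⟨ insertAt-penult-inject₁ c u (fromℕ n) ⟩
            c p                            ≡⟨ flow-fwd a c p a-penult ⟨
            flow a c p                     ≡⟨ insertAt-penult-inject₁ (flow a c) u (fromℕ n) ⟨
            ins (flow a c) u (inject₁ p)   ∎
    where
    open ≡-Reasoning
    p = inject₁ (fromℕ n)
  flow-extend c u v | hinge =
    trans (flow-fwd a′ (ins c u) h (extend-hinge a)) (trans (insertAt-lookup c h u) (sym (insertAt-lookup (flow a c) h u)))
  flow-extend c u v | new =
    trans (edgeFlow-cong (extend-last a) (insertAt-penult-last c u)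
            (trans (cong (ins c u) (next-fromℕ N)) (sym (cong c (next-fromℕ (suc n))))))
          (sym (insertAt-penult-last (flow a c) u))

  divergence-ins-inner : ∀ w u k → divergence (ins w u) (inject₁ (inject₁ k)) ≡ divergence w (inject₁ k)
  divergence-ins-inner w u k = cong₂ _-_ (insertAt-penult-inject₁ w u k) (ins-prev k)
    where
    ins-prev : ∀ k → ins w u (prev (inject₁ (inject₁ k))) ≡ w (prev (inject₁ k))
    ins-prev zero    = insertAt-penult-last w u
    ins-prev (suc k) = insertAt-penult-inject₁ w u (inject₁ k)

  divergence-ins-hinge : ∀ w u → divergence (ins w u) h ≡ u - w (inject₁ (fromℕ n))
  divergence-ins-hinge w u = cong₂ _-_ (insertAt-lookup w h u) (insertAt-penult-inject₁ w u (fromℕ n))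

  divergence-ins-new : ∀ w u → divergence (ins w u) (fromℕ N) ≡ w (fromℕ (suc n)) - u
  divergence-ins-new w u = cong₂ _-_ (insertAt-penult-last w u) (insertAt-lookup w h u)

  LT·-ins : ∀ c u v → LT· C′ (ins c u) v ≡ divergence (ins (flow a c) u) v
  LT·-ins c u v = trans (LT·-cycle a′ (ins c u) v) (cong₂ _-_ (flow-extend c u v) (flow-extend c u (prev v)))

  pad : Vector ℤ N → Vector ℤ N′
  pad x = insertAt x (fromℕ N) 0ℤ

  merge : Vector ℤ N′ → Vector ℤ N
  merge y = insertAt (init (init y)) (fromℕ (suc n)) (y h + y (fromℕ N))

  pad-inject₁ : ∀ x v → pad x (inject₁ v) ≡ x v
  pad-inject₁ x = insertAt-fromℕ-inject₁ x 0ℤ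

  pad-new : ∀ x → pad x (fromℕ N) ≡ 0ℤ
  pad-new x = insertAt-lookup x (fromℕ N) 0ℤ

  merge-inject₁ : ∀ y k → merge y (inject₁ k) ≡ y (inject₁ (inject₁ k))
  merge-inject₁ y = insertAt-fromℕ-inject₁ (init (init y)) _

  merge-last : ∀ y → merge y (fromℕ (suc n)) ≡ y h + y (fromℕ N)
  merge-last y = insertAt-lookup (init (init y)) (fromℕ (suc n)) _

  pad-cong : ∀ {x y} → x ≈[ C ] y → pad x ≈[ C′ ] pad y
  pad-cong {x} {y} (c , x-y≡) = ins c (W (fromℕ (suc n))) , λ v → trans (at v) (sym (LT·-ins c _ v))
    where
    W = flow a c
    x-y≡div : ∀ i → x i - y i ≡ divergence W i
    x-y≡div i = trans (x-y≡ i) (LT·-cycle a c i)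
    at : ∀ v → pad x v - pad y v ≡ divergence (ins W (W (fromℕ (suc n)))) v
    at v with extensionVertex v
    ... | inner k = trans (cong₂ _-_ (pad-inject₁ x _) (pad-inject₁ y _))
                      (trans (x-y≡div (inject₁ k)) (sym (divergence-ins-inner W _ k)))
    ... | hinge   = trans (cong₂ _-_ (pad-inject₁ x _) (pad-inject₁ y _))
                      (trans (x-y≡div (fromℕ (suc n))) (sym (divergence-ins-hinge W _)))
    ... | new     = trans (cong₂ _-_ (pad-new x) (pad-new y))
                      (trans (sym (ℤP.+-inverseʳ (W (fromℕ (suc n))))) (sym (divergence-ins-new W _)))

  merge-cong : ∀ {x y} → x ≈[ C′ ] y → merge x ≈[ C ] merge y
  merge-cong {x} {y} (c′ , x-y≡) = c , λ i → trans (at i) (sym (LT·-cycle a c i))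
    where
    c = removeAt c′ h
    W = flow a c
    x-y≡div : ∀ v → x v - y v ≡ divergence (ins W (c′ h)) v
    x-y≡div v = trans (x-y≡ v) (trans (LT·-cong C′ (λ v → sym (insertAt-removeAt c′ h v)) v) (LT·-ins c (c′ h) v))
    at : ∀ i → merge x i - merge y i ≡ divergence W i
    at i with inject₁-or-last i
    ... | inject k = trans (cong₂ _-_ (merge-inject₁ x k) (merge-inject₁ y k))
                       (trans (x-y≡div (inject₁ (inject₁ k))) (divergence-ins-inner W _ k))
    ... | last = begin
      merge x (fromℕ (suc n)) - merge y (fromℕ (suc n))
        ≡⟨ cong₂ _-_ (merge-last x) (merge-last y) ⟩
      (x h + x (fromℕ N)) - (y h + y (fromℕ N))
        ≡⟨ ring (x h) (x (fromℕ N)) (y h) (y (fromℕ N)) ⟩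
      (x h - y h) + (x (fromℕ N) - y (fromℕ N))
        ≡⟨ cong₂ _+_ (trans (x-y≡div h) (divergence-ins-hinge W _))
                     (trans (x-y≡div (fromℕ N)) (divergence-ins-new W _)) ⟩
      (c′ h - W (inject₁ (fromℕ n))) + (W (fromℕ (suc n)) - c′ h)
        ≡⟨ telescope (c′ h) (W (inject₁ (fromℕ n))) (W (fromℕ (suc n))) ⟩
      divergence W (fromℕ (suc n))
        ∎
      where
      open ≡-Reasoning
      ring : ∀ p q r s → (p + q) - (r + s) ≡ (p - r) + (q - s)
      ring = solve-∀
      telescope : ∀ u w₁ w₂ → (u - w₁) + (w₂ - u) ≡ w₂ - w₁
      telescope = solve-∀

  merge∘pad : ∀ x → merge (pad x) ≗ x
  merge∘pad x i with inject₁-or-last i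
  ... | inject k = trans (merge-inject₁ (pad x) k) (pad-inject₁ x (inject₁ k))
  ... | last     = trans (merge-last (pad x))
                     (trans (cong₂ _+_ (pad-inject₁ x (fromℕ (suc n))) (pad-new x)) (ℤP.+-identityʳ _))

  pad∘merge : ∀ y → pad (merge y) ≈[ C′ ] y
  pad∘merge y = ins (λ _ → 0ℤ) t , λ v → trans (at v) (sym (LT·-ins (λ _ → 0ℤ) t v))
    where
    t = y (fromℕ N)
    W₀ = flow a (λ _ → 0ℤ)
    W₀≡0 : ∀ k → W₀ k ≡ 0ℤ
    W₀≡0 k = edgeFlow-zero (a k)
    at : ∀ v → pad (merge y) v - y v ≡ divergence (ins W₀ t) v
    at v with extensionVertex v
    ... | inner k = begin
      pad (merge y) (inject₁ (inject₁ k)) - y (inject₁ (inject₁ k))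
        ≡⟨ cong (_- y (inject₁ (inject₁ k))) (trans (pad-inject₁ (merge y) (inject₁ k)) (merge-inject₁ y k)) ⟩
      y (inject₁ (inject₁ k)) - y (inject₁ (inject₁ k))
        ≡⟨ ℤP.+-inverseʳ (y (inject₁ (inject₁ k))) ⟩
      0ℤ
        ≡⟨ cong₂ _-_ (W₀≡0 (inject₁ k)) (W₀≡0 (prev (inject₁ k))) ⟨
      divergence W₀ (inject₁ k)
        ≡⟨ divergence-ins-inner W₀ t k ⟨
      divergence (ins W₀ t) (inject₁ (inject₁ k))
        ∎
      where open ≡-Reasoning
    ... | hinge = begin
      pad (merge y) h - y h
        ≡⟨ cong (_- y h) (trans (pad-inject₁ (merge y) (fromℕ (suc n))) (merge-last y)) ⟩
      (y h + t) - y h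
        ≡⟨ ring (y h) t ⟩
      t - 0ℤ
        ≡⟨ cong (λ w → t - w) (W₀≡0 (inject₁ (fromℕ n))) ⟨
      t - W₀ (inject₁ (fromℕ n))
        ≡⟨ divergence-ins-hinge W₀ t ⟨
      divergence (ins W₀ t) h
        ∎
      where
      open ≡-Reasoning
      ring : ∀ p q → (p + q) - p ≡ q - 0ℤ
      ring = solve-∀
    ... | new = begin
      pad (merge y) (fromℕ N) - t      ≡⟨ cong (_- t) (pad-new (merge y)) ⟩
      0ℤ - t                           ≡⟨ cong (_- t) (W₀≡0 (fromℕ (suc n))) ⟨
      W₀ (fromℕ (suc n)) - t           ≡⟨ divergence-ins-new W₀ t ⟨
      divergence (ins W₀ t) (fromℕ N)  ∎
      where open ≡-Reasoning

  C≅C′ : C ≅ᴾ C′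
  C≅C′ = ≅ᴾ-byInverse C C′ pad merge
    (λ x y → insertAt-zipWith _+_ x y (fromℕ N) 0ℤ 0ℤ)
    (insertAt-map (λ _ → 0ℤ) (λ _ → 0ℤ) (fromℕ N) 0ℤ)
    (λ x → insertAt-map -_ x (fromℕ N) 0ℤ)
    (λ {x} {y} → pad-cong {x} {y}) (λ {x} {y} → merge-cong {x} {y}) merge∘pad pad∘merge

penult≡inject₁-fromℕ : ∀ n → penult {suc n} ≡ inject₁ (fromℕ n)
penult≡inject₁-fromℕ n = toℕ-injective (trans (toℕ-fromℕ< _) (sym (trans (toℕ-inject₁ (fromℕ n)) (toℕ-fromℕ n))))

lemma4p4 : (m : ℕ) → 2 ℕ.≤ m → (a : Fin (suc m) → Arrow) →
    ¬ (∀ k → a k ≡ bi) →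
    (∃[ v ] (outdeg (cycle a) v ≡ 0 ⊎ outdeg (cycle a) v ≡ 1))
    × (outdeg (cycle a) (fromℕ m) ≡ 0 →
         cycle a ≅ᴾ cycle (degZeroExtension a))
    × (outdeg (cycle a) (fromℕ m) ≡ 1 →
       a penult ≡ fwd →
       (a (fromℕ m) ≡ fwd ⊎ a (fromℕ m) ≡ bi) →
         cycle a ≅ᴾ cycle (degOneExtension a))
lemma4p4 (suc m) _ a notAllBi =
    map₂ ≤1⇒≡0⊎≡1 (∃outdeg≤1 a notAllBi)
  , (λ outdeg≡0 → Extension.C≅C′ a (outdeg≡0⇒fwd-into a (fromℕ (suc m)) outdeg≡0))
  , (λ _ penult≡fwd _ → Extension.C≅C′ a (trans (cong a (sym (penult≡inject₁-fromℕ m))) penult≡fwd))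
  where
  ≤1⇒≡0⊎≡1 : ∀ {x} → x ℕ.≤ 1 → x ≡ 0 ⊎ x ≡ 1
  ≤1⇒≡0⊎≡1 ℕ.z≤n         = inj₁ refl
  ≤1⇒≡0⊎≡1 (ℕ.s≤s ℕ.z≤n) = inj₂ refl
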